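{- Let $n\ge 3$ and let $H$ be a 1-ordering of the path $P_n$ on $n$ vertices. Then $R_<(H)\le R(C_n)$, where $C_n$ is the $n$-cycle and $R(C_n)$ is its (unordered) two-color Ramsey number.
   Context: A $k$-ordering of a graph $H$ assigns distinct order-labels from $\{1,\ldots,|H|\}$ to $k$ of the vertices of $H$; a 1-ordering labels exactly one vertex. An ordered 2-coloring on $m$ vertices is a red/blue coloring of the edges of the complete graph on vertex set $\{1,\ldots,m\}$. It contains a $k$-ordering $H$ (in a given color) if it has a subgraph isomorphic to $H$, all of whose edges have that color, such that for every $i$ the $i$-th smallest vertex of the copy corresponds to a vertex of $H$ that has order-label $i$ or no order-label. $R_<(H)$ is the least $m$ such that every ordered 2-coloring on $m$ vertices contains a monochromatic copy of $H$. $R(C_n)$ is the least $m$ such that every red/blue coloring of the edges of $K_m$ contains a monochromatic copy of $C_n$. -}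

module Defs where

open import Data.Nat using (ℕ; zero; suc; _+_; _≤_; _<_)
open import Data.Fin using (Fin; toℕ; _<?_) renaming (zero to fzero; suc to fsuc)
open import Data.Bool using (Bool; true; false; if_then_else_)
open import Data.Product using (Σ; _×_; ∃)
open import Relation.Nullary using (¬_; does; yes; no)
open import Relation.Binary.PropositionalEquality using (_≡_)
open import Function.Definitions using (Injective)

-- A red/blue colouring of the edges of the complete graph on vertex set Fin m
-- (vertex i of Fin m stands for i+1).  Colours are Bool (true = red, false = blue).
-- Only the values  c i j  with  i < j  matter; edgeCol reads the colour of the
-- unordered pair {a , b}.
Coloring : ℕ → Set
Coloring m = Fin m → Fin m → Bool

edgeCol : ∀ {m} → Coloring m → Fin m → Fin m → Bool
edgeCol c a b = if does (a <? b) then c a b else c b a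

count : ∀ {n} → (Fin n → Bool) → ℕ
count {zero}  p = 0
count {suc n} p = (if p fzero then 1 else 0) + count (λ i → p (fsuc i))

csuc : ∀ {n} → Fin n → Fin n
csuc {suc n} i with toℕ i Data.Nat.<? n
... | yes p = Data.Fin.fromℕ< (Data.Nat.s≤s p)
... | no _  = fzero

MonoCopy : ∀ {n m} → (Fin n → Fin n → Set) → Coloring m → Bool → (Fin n → Fin m) → Set
MonoCopy {n} E c col f =
  Injective _≡_ _≡_ f × (∀ (i j : Fin n) → E i j → edgeCol c (f i) (f j) ≡ col)

CycleEdge : ∀ {n} → Fin n → Fin n → Set
CycleEdge i j = csuc i ≡ j

PathEdge : ∀ {n} → Fin n → Fin n → Set
PathEdge i j = suc (toℕ i) ≡ toℕ j

ArrowsCycle : ℕ → ℕ → Set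
ArrowsCycle n m = (c : Coloring m) → Σ Bool λ col → ∃ λ f → MonoCopy (CycleEdge {n}) c col f

IsCycleRamsey : ℕ → ℕ → Set
IsCycleRamsey n r = ArrowsCycle n r × (∀ m → ArrowsCycle n m → r ≤ m)

-- A 1-ordering of P_n : vertex v of P_n gets order-label ℓ+1 (ℓ : Fin n, 0-indexed).
-- An embedding f respects it iff f v is the (ℓ+1)-th smallest vertex of the image,
-- i.e. exactly ℓ vertices u of P_n have f u < f v.
Respects1 : ∀ {n m} → Fin n → Fin n → (Fin n → Fin m) → Set
Respects1 v ℓ f = count (λ u → does (f u <? f v)) ≡ toℕ ℓ

ArrowsOrdPath : (n : ℕ) → Fin n → Fin n → ℕ → Set
ArrowsOrdPath n v ℓ m = (c : Coloring m) →
  Σ Bool λ col → ∃ λ f → MonoCopy (PathEdge {n}) c col f × Respects1 v ℓ f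

IsOrdPathRamsey : (n : ℕ) → Fin n → Fin n → ℕ → Set
IsOrdPathRamsey n v ℓ r = ArrowsOrdPath n v ℓ r × (∀ m → ArrowsOrdPath n v ℓ m → r ≤ m)

-- Let g embed a monochromatic C_n.  The n vertices g 0 , … , g (n-1) are totally ordered, so
-- some cycle vertex x is mapped to the (ℓ+1)-th smallest of them.  Precomposing g with the
-- rotation of C_n taking v to x gives a copy of C_n with the same vertex set in which v is mapped
-- there; dropping the edge {n-1 , 0} leaves a monochromatic P_n respecting the 1-ordering.  So
-- R(C_n) vertices suffice, and as arrowing is decidable (finitely many colourings and
-- embeddings), the least sufficient number of vertices exists and is at most R(C_n).
module Submission where

open import Defs
open import Data.Nat using (ℕ; _≤_)
open import Data.Fin using (Fin)
open import Data.Product using (Σ; _×_)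
open import Data.Nat as ℕ using (zero; suc; _+_; _<_; z≤n; s≤s)
import Data.Nat.Properties as ℕP
open import Data.Fin as F using (toℕ; fromℕ; fromℕ<; inject₁; _<?_) renaming (zero to fzero; suc to fsuc)
import Data.Fin.Properties as FP
open import Data.Bool using (Bool; true; false; if_then_else_)
import Data.Bool.Properties as BP
open import Data.Vec using (Vec; []; _∷_; lookup; tabulate)
open import Data.Vec.Properties using (lookup∘tabulate)
open import Data.Product using (∃; _,_)
open import Data.Sum using (_⊎_; inj₁; inj₂)
open import Relation.Nullary using (¬_; Dec; does; yes; no; ¬?; contradiction)
open import Relation.Nullary.Decidable
  using (_×-dec_; _→-dec_; map′; dec-true; dec-false; decidable-stable)
open import Relation.Unary using (Decidable)
open import Relation.Binary using (tri<; tri≈; tri>)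
open import Relation.Binary.PropositionalEquality
open import Function using (_∘_; id)
open import Function.Definitions using (Injective)

private
  variable
    A : Set
    k m n : ℕ

iterate : (A → A) → ℕ → A → A
iterate s zero    = id
iterate s (suc k) = iterate s k ∘ s

iterate-injective : {s : A → A} → Injective _≡_ _≡_ s → ∀ k → Injective _≡_ _≡_ (iterate s k)
iterate-injective s-inj zero    e = e
iterate-injective s-inj (suc k) e = s-inj (iterate-injective s-inj k e)

iterate-commute : {s t : A → A} → (∀ a → s (t a) ≡ t (s a)) →
                  ∀ k a → iterate s k (t a) ≡ t (iterate s k a)
iterate-commute comm zero    a = refl
iterate-commute comm (suc k) a = trans (cong (iterate _ k) (comm a)) (iterate-commute comm k _)

iterate-inverse : {s t : A → A} → (∀ a → s (t a) ≡ a) → (∀ a → t (s a) ≡ a) →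
                  ∀ k a → iterate s k (iterate t k a) ≡ a
iterate-inverse {s = s} {t} st ts (suc k) a = begin
  iterate s k (s (iterate t k (t a)))  ≡⟨ cong (iterate s k) (iterate-commute comm k (t a)) ⟨
  iterate s k (iterate t k (s (t a)))  ≡⟨ cong (iterate s k ∘ iterate t k) (st a) ⟩
  iterate s k (iterate t k a)          ≡⟨ iterate-inverse st ts k a ⟩
  a                                    ∎
  where
  open ≡-Reasoning
  comm : ∀ b → t (s b) ≡ s (t b)
  comm b = trans (ts b) (sym (st b))
iterate-inverse st ts zero a = refl

indicator : Bool → ℕ
indicator b = if b then 1 else 0

indicator-mono : {b c : Bool} → (b ≡ true → c ≡ true) → indicator b ≤ indicator c
indicator-mono {false}         _ = z≤n
indicator-mono {true}  {true}  _ = ℕP.≤-refl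
indicator-mono {true}  {false} h with () ← h refl

count-cong : {p q : Fin n → Bool} → (∀ i → p i ≡ q i) → count p ≡ count q
count-cong {zero}  e = refl
count-cong {suc n} e = cong₂ _+_ (cong indicator (e fzero)) (count-cong (e ∘ fsuc))

count-mono : {p q : Fin n → Bool} → (∀ i → p i ≡ true → q i ≡ true) → count p ≤ count q
count-mono {zero}  h = z≤n
count-mono {suc n} h = ℕP.+-mono-≤ (indicator-mono (h fzero)) (count-mono (h ∘ fsuc))

count-strict : {p q : Fin n → Bool} → (∀ i → p i ≡ true → q i ≡ true) →
               (w : Fin n) → p w ≡ false → q w ≡ true → count p < count q
count-strict {p = p} {q} h fzero pw qw rewrite pw | qw = s≤s (count-mono (h ∘ fsuc))
count-strict h (fsuc w) pw qw =
  ℕP.+-mono-≤-< (indicator-mono (h fzero)) (count-strict (h ∘ fsuc) w pw qw)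

count-true : ∀ n → count {n} (λ _ → true) ≡ n
count-true zero    = refl
count-true (suc n) = cong suc (count-true n)

count<n : (p : Fin n → Bool) (w : Fin n) → p w ≡ false → count p < n
count<n {n} p w pw = subst (count p <_) (count-true n) (count-strict (λ _ _ → refl) w pw refl)

count-snoc : (p : Fin (suc n) → Bool) → count p ≡ count (p ∘ inject₁) + indicator (p (fromℕ n))
count-snoc {zero}  p = ℕP.+-comm (indicator (p fzero)) 0
count-snoc {suc n} p = trans (cong (indicator (p fzero) +_) (count-snoc (p ∘ fsuc)))
  (sym (ℕP.+-assoc (indicator (p fzero)) (count (p ∘ fsuc ∘ inject₁)) _))

count-iterate : {s : Fin n → Fin n} → (∀ p → count (p ∘ s) ≡ count p) →
                ∀ k (p : Fin n → Bool) → count (p ∘ iterate s k) ≡ count p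
count-iterate inv zero    p = refl
count-iterate inv (suc k) p = trans (inv (p ∘ iterate _ k)) (count-iterate inv k p)

csuc-toℕ : (i : Fin (suc n)) → toℕ i < n → toℕ (csuc i) ≡ suc (toℕ i)
csuc-toℕ {n} i i<n with toℕ i ℕ.<? n
... | yes i<n′ = FP.toℕ-fromℕ< (s≤s i<n′)
... | no  i≮n  = contradiction i<n i≮n

csuc-fromℕ : csuc (fromℕ n) ≡ fzero
csuc-fromℕ {n} with toℕ (fromℕ n) ℕ.<? n
... | yes n<n = contradiction (subst (_< n) (FP.toℕ-fromℕ n) n<n) (ℕP.<-irrefl refl)
... | no  _   = refl

csuc-inject₁ : (i : Fin n) → csuc (inject₁ i) ≡ fsuc i
csuc-inject₁ i = FP.toℕ-injective
  (trans (csuc-toℕ (inject₁ i) (FP.inject₁ℕ< i)) (cong suc (FP.toℕ-inject₁ i)))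

fromℕ-or-inject₁ : (x : Fin (suc n)) → x ≡ fromℕ n ⊎ ∃ λ i → x ≡ inject₁ i
fromℕ-or-inject₁ {zero}  fzero    = inj₁ refl
fromℕ-or-inject₁ {suc n} fzero    = inj₂ (fzero , refl)
fromℕ-or-inject₁ {suc n} (fsuc x) with fromℕ-or-inject₁ x
... | inj₁ x≡n       = inj₁ (cong fsuc x≡n)
... | inj₂ (i , x≡i) = inj₂ (fsuc i , cong fsuc x≡i)

pathEdge⇒cycleEdge : {i j : Fin n} → PathEdge i j → CycleEdge i j
pathEdge⇒cycleEdge {suc n} {i} {j} e = FP.toℕ-injective (trans (csuc-toℕ i i<n) e)
  where
  i<n : toℕ i < n
  i<n = ℕ.s≤s⁻¹ (subst (_< suc n) (sym e) (FP.toℕ<n j))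

cpred : Fin (suc n) → Fin (suc n)
cpred fzero    = fromℕ _
cpred (fsuc i) = inject₁ i

csuc-cpred : (x : Fin (suc n)) → csuc (cpred x) ≡ x
csuc-cpred fzero    = csuc-fromℕ
csuc-cpred (fsuc i) = csuc-inject₁ i

cpred-csuc : (x : Fin (suc n)) → cpred (csuc x) ≡ x
cpred-csuc x with fromℕ-or-inject₁ x
... | inj₁ refl       = cong cpred csuc-fromℕ
... | inj₂ (i , refl) = cong cpred (csuc-inject₁ i)

csuc-injective : Injective _≡_ _≡_ (csuc {suc n})
csuc-injective {x = x} {y} e = trans (sym (cpred-csuc x)) (trans (cong cpred e) (cpred-csuc y))

cpred-injective : Injective _≡_ _≡_ (cpred {n})
cpred-injective {x = x} {y} e = trans (sym (csuc-cpred x)) (trans (cong csuc e) (csuc-cpred y))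

count-∘-csuc : (p : Fin (suc n) → Bool) → count (p ∘ csuc) ≡ count p
count-∘-csuc {n} p = begin
  count (p ∘ csuc)                                        ≡⟨ count-snoc (p ∘ csuc) ⟩
  count (p ∘ csuc ∘ inject₁) + indicator (p (csuc (fromℕ n)))
    ≡⟨ cong₂ _+_ (count-cong (cong p ∘ csuc-inject₁)) (cong (indicator ∘ p) csuc-fromℕ) ⟩
  count (p ∘ fsuc) + indicator (p fzero)                  ≡⟨ ℕP.+-comm (count (p ∘ fsuc)) _ ⟩
  count p                                                 ∎
  where open ≡-Reasoning

count-∘-cpred : (p : Fin (suc n) → Bool) → count (p ∘ cpred) ≡ count p
count-∘-cpred p = trans (sym (count-∘-csuc (p ∘ cpred))) (count-cong (cong p ∘ cpred-csuc))

iterate-cpred-toℕ : ∀ k (y : Fin (suc n)) → toℕ y ≡ k → iterate cpred k y ≡ fzero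
iterate-cpred-toℕ zero    y        e = FP.toℕ-injective e
iterate-cpred-toℕ (suc k) (fsuc j) e =
  iterate-cpred-toℕ k (inject₁ j) (trans (FP.toℕ-inject₁ j) (ℕP.suc-injective e))

rotate : (v x : Fin (suc n)) → Fin (suc n) → Fin (suc n)
rotate v x = iterate csuc (toℕ x) ∘ iterate cpred (toℕ v)

rotate-source : (v x : Fin (suc n)) → rotate v x v ≡ x
rotate-source v x = begin
  iterate csuc (toℕ x) (iterate cpred (toℕ v) v)  ≡⟨ cong (iterate csuc (toℕ x)) (to-fzero v) ⟩
  iterate csuc (toℕ x) fzero                      ≡⟨ cong (iterate csuc (toℕ x)) (to-fzero x) ⟨
  iterate csuc (toℕ x) (iterate cpred (toℕ x) x)  ≡⟨ iterate-inverse csuc-cpred cpred-csuc (toℕ x) x ⟩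
  x                                               ∎
  where
  open ≡-Reasoning
  to-fzero : (y : Fin (suc _)) → iterate cpred (toℕ y) y ≡ fzero
  to-fzero y = iterate-cpred-toℕ (toℕ y) y refl

rotate-csuc : (v x u : Fin (suc n)) → rotate v x (csuc u) ≡ csuc (rotate v x u)
rotate-csuc v x u =
  trans (cong (iterate csuc (toℕ x)) (iterate-commute cpred∘csuc≡csuc∘cpred (toℕ v) u))
        (iterate-commute {t = csuc} (λ _ → refl) (toℕ x) _)
  where
  cpred∘csuc≡csuc∘cpred : ∀ a → cpred (csuc a) ≡ csuc (cpred a)
  cpred∘csuc≡csuc∘cpred a = trans (cpred-csuc a) (sym (csuc-cpred a))

rotate-injective : (v x : Fin (suc n)) → Injective _≡_ _≡_ (rotate v x)
rotate-injective v x =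
  iterate-injective cpred-injective (toℕ v) ∘ iterate-injective csuc-injective (toℕ x)

count-∘-rotate : (v x : Fin (suc n)) (p : Fin (suc n) → Bool) → count (p ∘ rotate v x) ≡ count p
count-∘-rotate v x p =
  trans (count-iterate count-∘-cpred (toℕ v) (p ∘ iterate csuc (toℕ x)))
        (count-iterate count-∘-csuc (toℕ x) p)

injective⇒surjective : {f : Fin (suc n) → Fin (suc n)} → Injective _≡_ _≡_ f →
                       ∀ y → ∃ λ x → f x ≡ y
injective⇒surjective {n} {f} f-inj y with FP.any? (λ x → f x F.≟ y)
... | yes hit = hit
... | no miss = contradiction (FP.injective⇒≤ f′-inj) ℕP.1+n≰n
  where
  y≢f : ∀ x → y ≢ f x
  y≢f x y≡fx = miss (x , sym y≡fx)
  f′ : Fin (suc n) → Fin n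
  f′ x = F.punchOut (y≢f x)
  f′-inj : Injective _≡_ _≡_ f′
  f′-inj = f-inj ∘ FP.punchOut-injective (y≢f _) (y≢f _)

-- Respects1 v ℓ f unfolds to rank f v ≡ toℕ ℓ.
rank : (Fin k → Fin m) → Fin k → ℕ
rank g x = count (λ w → does (g w <? g x))

rank-∘ : {σ : Fin k → Fin k} → (∀ p → count (p ∘ σ) ≡ count p) →
         (g : Fin k → Fin m) (u : Fin k) → rank (g ∘ σ) u ≡ rank g (σ u)
rank-∘ {σ = σ} inv g u = inv (λ w → does (g w <? g (σ u)))

does-mono : {P Q : Set} → (P → Q) → (p? : Dec P) (q? : Dec Q) → does p? ≡ true → does q? ≡ true
does-mono f (yes p) q? _ = dec-true q? (f p)

rank-strict : (g : Fin k → Fin m) {x y : Fin k} → g x F.< g y → rank g x < rank g y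
rank-strict g {x} {y} gx<gy =
  count-strict (λ w → does-mono (λ gw<gx → FP.<-trans gw<gx gx<gy) (g w <? g x) (g w <? g y))
    x (dec-false (g x <? g x) (FP.<-irrefl refl)) (dec-true (g x <? g y) gx<gy)

rank<k : (g : Fin k → Fin m) (x : Fin k) → rank g x < k
rank<k g x = count<n _ x (dec-false (g x <? g x) (FP.<-irrefl refl))

rank-injective : {g : Fin k → Fin m} → Injective _≡_ _≡_ g → Injective _≡_ _≡_ (rank g)
rank-injective {g = g} g-inj {x} {y} e with FP.<-cmp (g x) (g y)
... | tri< gx<gy _ _ = contradiction e (ℕP.<⇒≢ (rank-strict g gx<gy))
... | tri≈ _ gx≡gy _ = g-inj gx≡gy
... | tri> _ _ gy<gx = contradiction (sym e) (ℕP.<⇒≢ (rank-strict g gy<gx))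

rank-surjective : {g : Fin (suc n) → Fin m} → Injective _≡_ _≡_ g →
                  (ℓ : Fin (suc n)) → ∃ λ x → rank g x ≡ toℕ ℓ
rank-surjective {g = g} g-inj ℓ =
  let x , rankFin[x]≡ℓ = injective⇒surjective rankFin-inj ℓ
  in  x , trans (sym (FP.toℕ-fromℕ< (rank<k g x))) (cong toℕ rankFin[x]≡ℓ)
  where
  rankFin : Fin (suc _) → Fin (suc _)
  rankFin x = fromℕ< (rank<k g x)
  rankFin-inj : Injective _≡_ _≡_ rankFin
  rankFin-inj = rank-injective g-inj ∘ FP.fromℕ<-injective _ _ (rank<k g _) (rank<k g _)

cycleCopy⇒pathCopy : {c : Coloring m} {col : Bool} {g : Fin n → Fin m} →
                     MonoCopy CycleEdge c col g → MonoCopy PathEdge c col g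
cycleCopy⇒pathCopy (g-inj , g-edge) = g-inj , λ i j → g-edge i j ∘ pathEdge⇒cycleEdge

cycleCopy-rotate : {c : Coloring m} {col : Bool} {g : Fin (suc n) → Fin m} →
                   MonoCopy CycleEdge c col g → (v x : Fin (suc n)) →
                   MonoCopy CycleEdge c col (g ∘ rotate v x)
cycleCopy-rotate (g-inj , g-edge) v x =
  rotate-injective v x ∘ g-inj ,
  λ i j i→j → g-edge _ _ (trans (sym (rotate-csuc v x i)) (cong (rotate v x) i→j))

OrdPathCopy : (v ℓ : Fin n) → Coloring m → Bool → (Fin n → Fin m) → Set
OrdPathCopy v ℓ c col f = MonoCopy PathEdge c col f × Respects1 v ℓ f

cycleCopy⇒ordPathCopy : {c : Coloring m} {col : Bool} {g : Fin (suc n) → Fin m} →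
                        MonoCopy CycleEdge c col g → (v ℓ : Fin (suc n)) →
                        ∃ (OrdPathCopy v ℓ c col)
cycleCopy⇒ordPathCopy {c = c} {g = g} copy@(g-inj , _) v ℓ =
  let x , rank[x]≡ℓ = rank-surjective g-inj ℓ
      open ≡-Reasoning
  in  g ∘ rotate v x , cycleCopy⇒pathCopy {c = c} (cycleCopy-rotate {c = c} copy v x) , (begin
        rank (g ∘ rotate v x) v  ≡⟨ rank-∘ {σ = rotate v x} (count-∘-rotate v x) g v ⟩
        rank g (rotate v x v)    ≡⟨ cong (rank g) (rotate-source v x) ⟩
        rank g x                 ≡⟨ rank[x]≡ℓ ⟩
        toℕ ℓ                    ∎)

arrowsCycle⇒arrowsOrdPath : ArrowsCycle (suc n) m → (v ℓ : Fin (suc n)) → ArrowsOrdPath (suc n) v ℓ m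
arrowsCycle⇒arrowsOrdPath arrows v ℓ c =
  let col , _ , copy = arrows c in col , cycleCopy⇒ordPathCopy {c = c} copy v ℓ

Exhaustive : Set → Set₁
Exhaustive A = {P : A → Set} → Decidable P → Dec (∃ P)

Bool-exhaustive : Exhaustive Bool
Bool-exhaustive P? with P? true | P? false
... | yes p | _     = yes (true , p)
... | no _  | yes p = yes (false , p)
... | no ¬t | no ¬f = no λ { (true , p) → ¬t p ; (false , p) → ¬f p }

Vec-exhaustive : Exhaustive A → ∀ k → Exhaustive (Vec A k)
Vec-exhaustive A-ex zero    P? = map′ ([] ,_) (λ { ([] , p) → p }) (P? [])
Vec-exhaustive A-ex (suc k) P? =
  map′ (λ (a , as , p) → a ∷ as , p) (λ { (a ∷ as , p) → a , as , p })
       (A-ex λ a → Vec-exhaustive A-ex k (λ as → P? (a ∷ as)))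

Extensional : ((Fin k → A) → Set) → Set
Extensional P = ∀ {f g} → (∀ i → f i ≡ g i) → P f → P g

-- Without function extensionality, only extensional predicates can be decided by searching
-- through the finitely many tables of values.
function-exhaustive : Exhaustive A → {P : (Fin k → A) → Set} → Extensional P →
                      Decidable P → Dec (∃ P)
function-exhaustive {k = k} A-ex P-ext P? =
  map′ (λ (t , p) → lookup t , p)
       (λ (f , p) → tabulate f , P-ext (λ i → sym (lookup∘tabulate f i)) p)
       (Vec-exhaustive A-ex k (P? ∘ lookup))

function-all? : Exhaustive A → {P : (Fin k → A) → Set} → Extensional P →
                Decidable P → Dec (∀ f → P f)
function-all? A-ex {P} P-ext P?
  with function-exhaustive A-ex {λ f → ¬ P f} (λ f≗g ¬p → ¬p ∘ P-ext (sym ∘ f≗g)) (¬? ∘ P?)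
... | yes (f , ¬p) = no λ all → ¬p (all f)
... | no  none     = yes λ f → decidable-stable (P? f) (λ ¬p → none (f , ¬p))

coloring-all? : {Q : Coloring m → Set} → (∀ {c c′} → (∀ i j → c i j ≡ c′ i j) → Q c → Q c′) →
                Decidable Q → Dec (∀ c → Q c)
coloring-all? {m} {Q} Q-ext Q? =
  map′ (λ all c → Q-ext (λ i → lookup∘tabulate (c i)) (all (tabulate ∘ c)))
       (λ all t → all (lookup ∘ t))
       (function-all? (Vec-exhaustive Bool-exhaustive m)
                      (λ t≗t′ → Q-ext (λ i j → cong (λ row → lookup row j) (t≗t′ i)))
                      (Q? ∘ (lookup ∘_)))

edgeCol-cong : {c c′ : Coloring m} → (∀ i j → c i j ≡ c′ i j) → ∀ a b → edgeCol c a b ≡ edgeCol c′ a b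
edgeCol-cong {c = c} {c′} c≗c′ a b with does (a <? b)
... | true  = c≗c′ a b
... | false = c≗c′ b a

injective? : (f : Fin n → Fin m) → Dec (Injective _≡_ _≡_ f)
injective? f = map′ (λ inj {x} {y} → inj x y) (λ inj x y → inj)
  (FP.all? λ x → FP.all? λ y → (f x F.≟ f y) →-dec (x F.≟ y))

ordPathCopy? : (v ℓ : Fin n) (c : Coloring m) (col : Bool) → Decidable (OrdPathCopy v ℓ c col)
ordPathCopy? v ℓ c col f =
  (injective? f ×-dec
   FP.all? (λ i → FP.all? λ j → (suc (toℕ i) ℕ.≟ toℕ j) →-dec (edgeCol c (f i) (f j) BP.≟ col)))
  ×-dec (rank f v ℕ.≟ toℕ ℓ)

ordPathCopy-extensional : (v ℓ : Fin n) (c : Coloring m) (col : Bool) →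
                          Extensional (OrdPathCopy v ℓ c col)
ordPathCopy-extensional v ℓ c col f≗g ((f-inj , f-edge) , f-resp) =
  ( (λ {x} {y} gx≡gy → f-inj (trans (f≗g x) (trans gx≡gy (sym (f≗g y)))))
  , (λ i j i→j → trans (cong₂ (edgeCol c) (sym (f≗g i)) (sym (f≗g j))) (f-edge i j i→j)) )
  , trans (count-cong (λ u → cong₂ (λ a b → does (a <? b)) (sym (f≗g u)) (sym (f≗g v)))) f-resp

arrowsOrdPath? : ∀ n (v ℓ : Fin n) m → Dec (ArrowsOrdPath n v ℓ m)
arrowsOrdPath? n v ℓ m = coloring-all? recolour λ c →
  Bool-exhaustive λ col →
  function-exhaustive FP.any? (ordPathCopy-extensional v ℓ c col) (ordPathCopy? v ℓ c col)
  where
  recolour : ∀ {c c′} → (∀ i j → c i j ≡ c′ i j) →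
             Σ Bool (λ col → ∃ (OrdPathCopy v ℓ c col)) → Σ Bool (λ col → ∃ (OrdPathCopy v ℓ c′ col))
  recolour c≗c′ (col , f , (f-inj , f-edge) , f-resp) =
    col , f , (f-inj , λ i j i→j → trans (sym (edgeCol-cong c≗c′ (f i) (f j))) (f-edge i j i→j)) , f-resp

least-satisfying : {P : ℕ → Set} → Decidable P → ∀ {r} → P r →
                   ∃ λ s → P s × s ≤ r × (∀ m → P m → s ≤ m)
least-satisfying {P} P? {r} P[r] =
  let i , ¬¬P[i] , below = FP.¬∀⟶∃¬-smallest (suc r) (λ i → ¬ P (toℕ i)) (¬? ∘ P? ∘ toℕ)
                             (λ none → none (fromℕ r) (subst P (sym (FP.toℕ-fromℕ r)) P[r]))
  in  toℕ i , decidable-stable (P? (toℕ i)) ¬¬P[i] , FP.toℕ≤pred[n] i ,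
      λ m P[m] → ℕP.≮⇒≥ λ m<i →
        below (fromℕ< m<i) (subst P (sym (trans (FP.toℕ-inject _) (FP.toℕ-fromℕ< m<i))) P[m])

theorem4p1 : (n : ℕ) → 3 ≤ n → (v ℓ : Fin n) → (r : ℕ) → IsCycleRamsey n r →
    Σ ℕ λ s → IsOrdPathRamsey n v ℓ s × s ≤ r
theorem4p1 (suc n) _ v ℓ r (arrows , _) =
  let s , arrows[s] , s≤r , s-least =
        least-satisfying (arrowsOrdPath? (suc n) v ℓ) (arrowsCycle⇒arrowsOrdPath arrows v ℓ)
  in  s , (arrows[s] , s-least) , s≤r
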